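{- Let $G$ be a graph. Then $G$ is cop-win if and only if $G$ has finite corner rank. Furthermore, if $G$ is an $r$-cop-win graph ($r\in\{0,1\}$) of finite corner rank $\alpha\ge 2$, then $\operatorname{capt}(G)=\alpha-r$.
   Context: All graphs are finite, have at least one vertex, and are reflexive: every vertex is regarded as adjacent to itself. For a vertex $v$, $N[v]$ is its closed neighborhood (all vertices adjacent to $v$, including $v$). For distinct vertices $v,w$ of a graph $H$: $w$ corners $v$ in $H$ if every vertex of $H$ adjacent to $v$ is adjacent to $w$; $w$ strictly corners $v$ in $H$ if moreover some vertex of $H$ adjacent to $w$ is not adjacent to $v$; $v,w$ are twins in $H$ if their closed neighborhoods in $H$ coincide. A strict corner of $H$ is a vertex strictly cornered in $H$ by some other vertex. $G-X$ denotes the subgraph induced by $V(G)\setminus X$. Corner ranking: define $\mathrm{cr}:V(G)\to\{1,2,\dots\}\cup\{\infty\}$ and graphs $G_1,G_2,\dots$ as follows. Set $G_1=G$, $k=1$. If $G_k$ is a clique, set $\mathrm{cr}(x)=k$ for all $x\in V(G_k)$ and stop. Else, if $G_k$ has no strict corners, set $\mathrm{cr}(x)=\infty$ for all $x\in V(G_k)$ and stop. Else let $X$ be the set of strict corners of $G_k$, set $\mathrm{cr}(x)=k$ for $x\in X$, let $G_{k+1}=G_k-X$, increase $k$ by one and repeat. The corner rank $\mathrm{cr}(G)$ is the largest value of $\mathrm{cr}$ on $V(G)$ ($\infty$ exceeding all integers); $G$ has finite corner rank if $\mathrm{cr}(G)$ is an integer. For $G$ of finite corner rank $\alpha\ge 2$: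 $G$ is $1$-cop-win if some (equivalently, every) vertex of rank $\alpha$ is adjacent to every vertex of $G_{\alpha-1}$; otherwise $G$ is $0$-cop-win. Game of cops and robber (one cop, one robber): the cop chooses a starting vertex, then the robber does; then they alternate moves, the cop moving first; a move consists of staying put or moving to an adjacent vertex; the cop wins if both occupy the same vertex. $G$ is cop-win if the cop can force a win. For cop-win $G$, the capture time $\operatorname{capt}(G)$ is the minimum number of cop moves (the initial placement not counted) within which the cop can guarantee a win. -}

module Defs where

open import Data.Nat using (ℕ; zero; suc; _≤_; _<_)
open import Data.Fin using (Fin)
open import Data.Bool using (Bool; true)
open import Data.Product using (Σ; ∃; _×_; _,_)
open import Data.Sum using (_⊎_)
open import Data.Unit using (⊤)
open import Relation.Nullary using (¬_)
open import Relation.Binary.PropositionalEquality using (_≡_; _≢_)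

record Graph : Set where
  field
    n       : ℕ
    adj     : Fin (suc n) → Fin (suc n) → Bool
    adj-refl : ∀ v → adj v v ≡ true
    adj-sym  : ∀ u v → adj u v ≡ adj v u

module _ (G : Graph) where
  open Graph G

  Vtx : Set
  Vtx = Fin (suc n)

  Adj : Vtx → Vtx → Set
  Adj u v = adj u v ≡ true

  -- vertex subsets (used for induced subgraphs)
  VSet : Set₁
  VSet = Vtx → Set

  Corners : VSet → Vtx → Vtx → Set
  Corners S w v = ∀ u → S u → Adj u v → Adj u w

  StrictlyCorners : VSet → Vtx → Vtx → Set
  StrictlyCorners S w v =
    Corners S w v × Σ Vtx (λ u → S u × Adj u w × ¬ Adj u v)

  StrictCorner : VSet → Vtx → Set
  StrictCorner S v =
    S v × Σ Vtx (λ w → S w × w ≢ v × StrictlyCorners S w v)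

  IsClique : VSet → Set
  IsClique S = ∀ u v → S u → S v → Adj u v

  -- Stage k = vertex set of G_k (for k ≥ 1); Stage 0 is an unused copy of G_1.
  -- G_{k+1} = G_k minus the strict corners of G_k.  (If G_k is a clique or has
  -- no strict corners, nothing is removed, matching the stopped process.)
  Stage : ℕ → VSet
  Stage zero          v = ⊤
  Stage (suc zero)    v = ⊤
  Stage (suc (suc k)) v = Stage (suc k) v × ¬ StrictCorner (Stage (suc k)) v

  -- cr(x) = k  (k a positive integer), following the corner-ranking procedure:
  -- the procedure has not stopped before stage k (no G_j with j < k is a clique,
  -- and every earlier stage had strict corners, which is implied since x
  -- survives to stage k and receives a rank there), x ∈ G_k, and x is either a
  -- strict corner of G_k or G_k is a clique.
  HasRank : Vtx → ℕ → Set
  HasRank x k =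
    1 ≤ k
    × (∀ j → 1 ≤ j → j < k → ¬ IsClique (Stage j))
    × Stage k x
    × (StrictCorner (Stage k) x ⊎ IsClique (Stage k))

  CornerRank : ℕ → Set
  CornerRank α =
    (∀ x → ∃ λ k → HasRank x k)
    × (∃ λ x → HasRank x α)
    × (∀ x k → HasRank x k → k ≤ α)

  FiniteCornerRank : Set
  FiniteCornerRank = ∃ λ α → CornerRank α

  OneCopWinCond : ℕ → Set
  OneCopWinCond α = ∃ λ v → HasRank v α × (∀ u → Stage (α Data.Nat.∸ 1) u → Adj v u)

  RCopWin : ℕ → ℕ → Set
  RCopWin r α =
    CornerRank α × 2 ≤ α
    × ((r ≡ 1 × OneCopWinCond α) ⊎ (r ≡ 0 × ¬ OneCopWinCond α))

  -- Cops and robber.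
  -- CopWinsWithin t c r : cop on c, robber on r, cop to move; the cop can
  -- force capture using at most t further cop moves.
  CopWinsWithin : ℕ → Vtx → Vtx → Set
  CopWinsWithin zero    c r = c ≡ r
  CopWinsWithin (suc t) c r =
    c ≡ r ⊎ Σ Vtx (λ c′ → Adj c c′ ×
               (c′ ≡ r ⊎ (∀ r′ → Adj r r′ → CopWinsWithin t c′ r′)))

  CanCaptureWithin : ℕ → Set
  CanCaptureWithin t = Σ Vtx (λ c₀ → ∀ r₀ → CopWinsWithin t c₀ r₀)

  CopWin : Set
  CopWin = ∃ λ t → CanCaptureWithin t

  CaptureTime : ℕ → Set
  CaptureTime t = CanCaptureWithin t × (∀ s → CanCaptureWithin s → t ≤ s)

-- Let G₁ ⊇ G₂ ⊇ … be the stages of the corner ranking.  Following strict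
-- corners upwards (closed neighbourhoods grow strictly) sends each vertex of
-- Gₖ to a vertex of Gₖ₊₁ cornering it; this is a retraction Gₖ → Gₖ₊₁, and
-- composing gives retractions ρₖ : G → Gₖ.  A cop adjacent to ρₖ₊₁(r) catches
-- a robber at r within k + 1 moves by stepping onto ρₖ₊₁(r), which is adjacent
-- to ρₖ(r′) wherever the robber goes.  Conversely a robber in Gₖ₊₁ off the
-- neighbourhood of ρₖ₊₁(c) survives k + 1 moves: if he had no such move left,
-- ρₖ₊₂ of the cop's new position would strictly corner him in Gₖ₊₁.  So a cop
-- capturing within t + 1 moves starts at some c with ρₜ₊₂(c) dominating Gₜ₊₁,
-- which makes Gₜ₊₂ a clique; everything is read off from the first clique stage.
module Submission where

open import Level using (Level)
open import Data.Nat using (ℕ; zero; suc; _≤_; _<_; _∸_; z≤n; s≤s)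
open import Data.Nat.Properties using (≤-pred; ≤-trans; ≮⇒≥; m≤n⇒m<n∨m≡n; m<n⇒m<1+n; n<1+n)
  renaming (_≟_ to _≟ℕ_)
open import Data.Fin using (Fin; zero; suc)
open import Data.Fin.Properties using (any?; all?; _≟_)
open import Data.Fin.Subset using (Subset; _∈_; _⊂_; _⊃_)
open import Data.Fin.Subset.Induction using (Acc; acc; ⊃-wellFounded)
open import Data.Vec using (tabulate)
open import Data.Vec.Properties using (lookup∘tabulate; lookup⇒[]=; []=⇒lookup)
open import Data.Bool using (true)
open import Data.Bool.Properties using () renaming (_≟_ to _≟ᵇ_)
open import Data.Unit using (tt)
open import Data.Product using (Σ; ∃; _×_; _,_; proj₁; proj₂)
open import Data.Sum using (_⊎_; inj₁; inj₂; [_,_])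
open import Data.Empty using (⊥-elim)
open import Relation.Nullary using (¬_; Dec; yes; no; does; contradiction)
open import Relation.Nullary.Decidable using (_×-dec_; _⊎-dec_; _→-dec_; ¬?; dec-true; decidable-stable)
open import Relation.Unary using (Pred; Decidable)
open import Relation.Binary.PropositionalEquality using (_≡_; refl; sym; trans; subst)
open import Function.Bundles using (_⇔_; mk⇔)
open import Defs

private
  variable
    ℓ : Level

least : {P : Pred ℕ ℓ} → Decidable P → ∀ {m} → P m →
        ∃ λ k → P k × (∀ {j} → j < k → ¬ P j)
least P? {zero} p = zero , p , λ ()
least P? {suc m} p with P? zero | least (λ j → P? (suc j)) p
... | yes p₀ | _                = zero , p₀ , λ ()
... | no ¬p₀ | k , pₖ , below = suc k , pₖ , λ { {zero} _ → ¬p₀ ; {suc j} (s≤s j<k) → below j<k }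

module _ {m : ℕ} {P : Pred (Fin m) ℓ} (P? : Decidable P) where

  fromDecidable : Subset m
  fromDecidable = tabulate (λ i → does (P? i))

  ∈-fromDecidable⁺ : ∀ {i} → P i → i ∈ fromDecidable
  ∈-fromDecidable⁺ {i} p = lookup⇒[]= i _ (trans (lookup∘tabulate _ i) (dec-true (P? i) p))

  ∈-fromDecidable⁻ : ∀ {i} → i ∈ fromDecidable → P i
  ∈-fromDecidable⁻ {i} i∈ with P? i | trans (sym (lookup∘tabulate _ i)) ([]=⇒lookup i∈)
  ... | yes p | _ = p

fromDecidable-⊂ : ∀ {m} {P Q : Pred (Fin m) ℓ} (P? : Decidable P) (Q? : Decidable Q) →
                  (∀ {i} → P i → Q i) → (∃ λ i → Q i × ¬ P i) →
                  fromDecidable P? ⊂ fromDecidable Q?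
fromDecidable-⊂ P? Q? P⇒Q (i , qᵢ , ¬pᵢ) =
  (λ i∈P → ∈-fromDecidable⁺ Q? (P⇒Q (∈-fromDecidable⁻ P? i∈P))) ,
  i , ∈-fromDecidable⁺ Q? qᵢ , λ i∈P → ¬pᵢ (∈-fromDecidable⁻ P? i∈P)

module _ (G : Graph) where
  open Graph G

  private
    V : Set
    V = Vtx G

    variable
      T : VSet G
      u v w c r : V
      k t s α : ℕ

  Adj? : ∀ u v → Dec (Adj G u v)
  Adj? u v = adj u v ≟ᵇ true

  Adj-sym : Adj G u v → Adj G v u
  Adj-sym {u} {v} a = trans (adj-sym v u) a

  Corners-refl : Corners G T v v
  Corners-refl _ _ a = a

  Corners-trans : Corners G T w v → Corners G T v u → Corners G T w u
  Corners-trans w≽v v≽u x tx a = w≽v x tx (v≽u x tx a)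

  corner-adj : Corners G T w v → T u → Adj G v u → Adj G w u
  corner-adj w≽v tu a = Adj-sym (w≽v _ tu (Adj-sym a))

  Survives : VSet G → VSet G
  Survives T v = T v × ¬ StrictCorner G T v

  -- A dominating vertex strictly corners every vertex with a non-neighbour.
  dominating⇒survivors-clique : T w → (∀ u → T u → Adj G w u) → IsClique G (Survives T)
  dominating⇒survivors-clique {w = w} tw dom x y (tx , x-survives) (ty , _) with Adj? x y | x ≟ w
  ... | yes a | _    = a
  ... | no ¬a | yes refl = contradiction (dom y ty) ¬a
  ... | no ¬a | no x≢w  = contradiction
    (tx , w , tw , (λ w≡x → x≢w (sym w≡x)) , (λ u tu _ → Adj-sym (dom u tu)) ,
     y , ty , Adj-sym (dom y ty) , λ a → ¬a (Adj-sym a))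
    x-survives

  nonneighbour-or-dominating : Decidable T → ∀ d →
    (∃ λ r → T r × ¬ Adj G d r) ⊎ (∀ u → T u → Adj G d u)
  nonneighbour-or-dominating T? d with any? (λ r → T? r ×-dec ¬? (Adj? d r))
  ... | yes (r , tr , ¬a) = inj₁ (r , tr , ¬a)
  ... | no none = inj₂ λ u tu → decidable-stable (Adj? d u) λ ¬a → none (u , tu , ¬a)

  escape-or-cornered : Decidable T → ∀ d r →
    (∃ λ r′ → Adj G r r′ × T r′ × ¬ Adj G d r′) ⊎ Corners G T d r
  escape-or-cornered T? d r with nonneighbour-or-dominating (λ u → Adj? r u ×-dec T? u) d
  ... | inj₁ (r′ , (a , tr′) , ¬a) = inj₁ (r′ , a , tr′ , ¬a)
  ... | inj₂ dom                  = inj₂ λ u tu a → Adj-sym (dom u (Adj-sym a , tu))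

  module _ {T : VSet G} (T? : Decidable T) where

    Corners? : ∀ w v → Dec (Corners G T w v)
    Corners? w v = all? (λ u → T? u →-dec (Adj? u v →-dec Adj? u w))

    StrictCorner? : Decidable (StrictCorner G T)
    StrictCorner? v = T? v ×-dec any? (λ w → T? w ×-dec ¬? (w ≟ v) ×-dec
      (Corners? w v ×-dec any? (λ u → T? u ×-dec Adj? u w ×-dec ¬? (Adj? u v))))

    Survives? : Decidable (Survives T)
    Survives? v = T? v ×-dec ¬? (StrictCorner? v)

    InNeighbourhood? : ∀ v → Decidable (λ u → T u × Adj G u v)
    InNeighbourhood? v u = T? u ×-dec Adj? u v

    neighbourhood : V → Subset (suc n)
    neighbourhood v = fromDecidable (InNeighbourhood? v)

    strictly-corners⇒neighbourhood-⊃ : StrictlyCorners G T w v → neighbourhood w ⊃ neighbourhood v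
    strictly-corners⇒neighbourhood-⊃ (w≽v , u , tu , a , ¬a) =
      fromDecidable-⊂ (InNeighbourhood? _) (InNeighbourhood? _)
        (λ (tx , ax) → tx , w≽v _ tx ax) (u , (tu , a) , λ (_ , a′) → ¬a a′)

    climb : ∀ v → Acc _⊃_ (neighbourhood v) →
            Σ V λ w → (T v → Survives T w × Corners G T w v) × (Survives T v → w ≡ v)
    climb v (acc larger) with StrictCorner? v
    ... | no ¬sc = v , (λ tv → (tv , ¬sc) , Corners-refl) , λ _ → refl
    ... | yes sc@(_ , w , tw , _ , w≻v) with climb w (larger (strictly-corners⇒neighbourhood-⊃ w≻v))
    ...   | w′ , spec , _ =
      w′ , (λ _ → proj₁ (spec tw) , Corners-trans (proj₂ (spec tw)) (proj₁ w≻v)) ,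
      λ (_ , ¬sc) → contradiction sc ¬sc

    toSurvivor : V → V
    toSurvivor v = proj₁ (climb v (⊃-wellFounded _))

    toSurvivor-survives : T v → Survives T (toSurvivor v)
    toSurvivor-survives {v} tv = proj₁ (proj₁ (proj₂ (climb v (⊃-wellFounded _))) tv)

    toSurvivor-corners : T v → Corners G T (toSurvivor v) v
    toSurvivor-corners {v} tv = proj₂ (proj₁ (proj₂ (climb v (⊃-wellFounded _))) tv)

    toSurvivor-fixes : Survives T v → toSurvivor v ≡ v
    toSurvivor-fixes {v} sv = proj₂ (proj₂ (climb v (⊃-wellFounded _))) sv

  Stage? : ∀ k → Decidable (Stage G k)
  Stage? zero          _ = yes tt
  Stage? (suc zero)    _ = yes tt
  Stage? (suc (suc k)) v = Survives? (Stage? (suc k)) v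

  Stage-suc-⊆ : Stage G (suc k) v → Stage G k v
  Stage-suc-⊆ {zero}        _ = tt
  Stage-suc-⊆ {suc zero}    _ = tt
  Stage-suc-⊆ {suc (suc k)} (sv , _) = sv

  Stage-antitone : k ≤ t → Stage G t v → Stage G k v
  Stage-antitone {t = zero}  z≤n sv = sv
  Stage-antitone {t = suc t} k≤t sv with m≤n⇒m<n∨m≡n k≤t
  ... | inj₁ (s≤s k≤t′) = Stage-antitone k≤t′ (Stage-suc-⊆ sv)
  ... | inj₂ refl      = sv

  survives-until : ∀ j → (∀ {i} → i < j → ¬ StrictCorner G (Stage G (suc i)) v) →
                   Stage G (suc j) v
  survives-until zero    _        = tt
  survives-until (suc j) never-sc =
    survives-until j (λ i<j → never-sc (m<n⇒m<1+n i<j)) , never-sc (n<1+n j)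

  IsClique? : ∀ k → Dec (IsClique G (Stage G k))
  IsClique? k = all? λ u → all? λ v → Stage? k u →-dec (Stage? k v →-dec Adj? u v)

  step : ℕ → V → V
  step zero    v = v
  step (suc k) v = toSurvivor (Stage? (suc k)) v

  step-into : ∀ k → Stage G k v → Stage G (suc k) (step k v)
  step-into zero    _  = tt
  step-into (suc k) sv = toSurvivor-survives (Stage? (suc k)) sv

  step-corners : ∀ k → Stage G k v → Corners G (Stage G k) (step k v) v
  step-corners zero    _  = Corners-refl
  step-corners (suc k) sv = toSurvivor-corners (Stage? (suc k)) sv

  step-fixes : Stage G (suc k) v → step k v ≡ v
  step-fixes {zero}  _  = refl
  step-fixes {suc k} sv = toSurvivor-fixes (Stage? (suc k)) sv

  step-adj : ∀ k → Stage G k u → Stage G k v → Adj G u v → Adj G (step k u) v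
  step-adj k su sv a = corner-adj (step-corners k su) sv a

  retraction : ℕ → V → V
  retraction zero    v = v
  retraction (suc k) v = step k (retraction k v)

  retraction-into : ∀ k → Stage G k (retraction k v)
  retraction-into zero    = tt
  retraction-into (suc k) = step-into k (retraction-into k)

  retraction-fixes : Stage G k v → retraction k v ≡ v
  retraction-fixes {zero}  _  = refl
  retraction-fixes {suc k} sv rewrite retraction-fixes {k} (Stage-suc-⊆ sv) = step-fixes sv

  retraction-preserves-Adj : ∀ k → Adj G u v → Adj G (retraction k u) (retraction k v)
  retraction-preserves-Adj zero    a = a
  retraction-preserves-Adj (suc k) a =
    step-adj k (retraction-into k) (Stage-suc-⊆ (retraction-into (suc k)))
      (Adj-sym (step-adj k (retraction-into k) (retraction-into k)
        (Adj-sym (retraction-preserves-Adj k a))))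

  CopWinsWithin-suc : CopWinsWithin G t c r → CopWinsWithin G (suc t) c r
  CopWinsWithin-suc {zero}  c≡r                      = inj₁ c≡r
  CopWinsWithin-suc {suc t} (inj₁ c≡r)               = inj₁ c≡r
  CopWinsWithin-suc {suc t} (inj₂ (c′ , a , inj₁ c′≡r)) = inj₂ (c′ , a , inj₁ c′≡r)
  CopWinsWithin-suc {suc t} (inj₂ (c′ , a , inj₂ win)) =
    inj₂ (c′ , a , inj₂ λ r′ a′ → CopWinsWithin-suc (win r′ a′))

  CopWinsWithin-mono : s ≤ t → CopWinsWithin G s c r → CopWinsWithin G t c r
  CopWinsWithin-mono {t = zero}  z≤n win = win
  CopWinsWithin-mono {t = suc t} s≤t win with m≤n⇒m<n∨m≡n s≤t
  ... | inj₁ (s≤s s≤t′) = CopWinsWithin-suc (CopWinsWithin-mono s≤t′ win)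
  ... | inj₂ refl      = win

  CanCaptureWithin-mono : s ≤ t → CanCaptureWithin G s → CanCaptureWithin G t
  CanCaptureWithin-mono s≤t (c₀ , win) = c₀ , λ r₀ → CopWinsWithin-mono s≤t (win r₀)

  capture-by-shadowing : ∀ k → Adj G c (retraction (suc k) r) → CopWinsWithin G (suc k) c r
  capture-by-shadowing {r = r} zero    a = inj₂ (r , a , inj₁ refl)
  capture-by-shadowing {r = r} (suc k) a =
    inj₂ (retraction (suc (suc k)) r , a , inj₂ λ r′ r~r′ →
      capture-by-shadowing k (step-adj (suc k) (retraction-into (suc k)) (retraction-into (suc k))
        (retraction-preserves-Adj (suc k) r~r′)))

  evasion : ∀ k → Stage G (suc k) r → ¬ Adj G (retraction (suc k) c) r →
            ¬ CopWinsWithin G (suc k) c r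
  evasion zero _ ¬a (inj₁ refl)                 = ¬a (adj-refl _)
  evasion zero _ ¬a (inj₂ (_ , a , inj₁ refl))   = ¬a a
  evasion {r} zero _ ¬a (inj₂ (_ , a , inj₂ win)) with win r (adj-refl r)
  ... | refl = ¬a a
  evasion (suc k) sr ¬a (inj₁ refl) =
    ¬a (subst (λ x → Adj G x _) (sym (retraction-fixes sr)) (adj-refl _))
  evasion (suc k) sr ¬a (inj₂ (_ , a , inj₁ refl)) =
    ¬a (subst (Adj G _) (retraction-fixes sr) (retraction-preserves-Adj (suc (suc k)) a))
  evasion {r} {c} (suc k) (sr , r-survives) ¬a (inj₂ (c′ , a , inj₂ win))
    with escape-or-cornered (Stage? (suc k)) (retraction (suc k) c′) r
  -- If r cannot escape, d′ strictly corners r in Stage (suc k), as e shows.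
  ... | inj₁ (r′ , r~r′ , sr′ , ¬a′) = evasion k sr′ ¬a′ (win r′ r~r′)
  ... | inj₂ d≽r = r-survives (sr , d′ , proj₁ (retraction-into (suc (suc k))) , d′≢r , d′≽r ,
                               e , proj₁ (retraction-into (suc (suc k))) , e~d′ , ¬a)
    where
    d′ e : V
    d′ = retraction (suc (suc k)) c′
    e  = retraction (suc (suc k)) c
    d′≽r : Corners G (Stage G (suc k)) d′ r
    d′≽r = Corners-trans (step-corners (suc k) (retraction-into (suc k))) d≽r
    e~d′ : Adj G e d′
    e~d′ = retraction-preserves-Adj (suc (suc k)) a
    d′≢r : ¬ d′ ≡ r
    d′≢r d′≡r = ¬a (subst (Adj G e) d′≡r e~d′)

  capture⇒dominating : ∀ k {c₀} → (∀ r → CopWinsWithin G (suc k) c₀ r) →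
                       ∀ u → Stage G (suc k) u → Adj G (retraction (suc (suc k)) c₀) u
  capture⇒dominating k win with nonneighbour-or-dominating (Stage? (suc k)) (retraction (suc k) _)
  ... | inj₁ (r , sr , ¬a) = ⊥-elim (evasion k sr ¬a (win r))
  ... | inj₂ dom          = λ u su → step-adj (suc k) (retraction-into (suc k)) su (dom u su)

  capture⇒clique : ∀ t → CanCaptureWithin G t → IsClique G (Stage G (suc t))
  capture⇒clique zero (c₀ , win) x y _ _ with win x | win y
  ... | refl | refl = adj-refl c₀
  capture⇒clique (suc k) (c₀ , win) =
    dominating⇒survivors-clique (proj₁ (retraction-into (suc (suc k)))) (capture⇒dominating k win)

  dominating⇒capture : ∀ k → (∀ u → Stage G (suc k) u → Adj G w u) → CanCaptureWithin G (suc k)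
  dominating⇒capture {w} k dom = w , λ r₀ → capture-by-shadowing k (dom _ (retraction-into (suc k)))

  CornerRank⇒no-earlier-clique : CornerRank G α → ∀ j → 1 ≤ j → j < α → ¬ IsClique G (Stage G j)
  CornerRank⇒no-earlier-clique (_ , (_ , (_ , earlier , _)) , _) = earlier

  CornerRank⇒clique : CornerRank G α → IsClique G (Stage G α)
  CornerRank⇒clique {α} cr@(ranked , _ , bounded) with ranked (retraction (suc α) zero)
  ... | k , rank@(1≤k , _ , _ , inj₂ clique) with m≤n⇒m<n∨m≡n (bounded _ k rank)
  ...   | inj₁ k<α = contradiction clique (CornerRank⇒no-earlier-clique cr k 1≤k k<α)
  ...   | inj₂ refl = clique
  CornerRank⇒clique {α} (ranked , _ , bounded) | suc k , rank@(_ , _ , _ , inj₁ sc) =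
    ⊥-elim (proj₂ (Stage-antitone (s≤s (bounded _ (suc k) rank)) (retraction-into (suc α))) sc)

  CornerRank⇒capture : CornerRank G α → CanCaptureWithin G α
  CornerRank⇒capture {zero}  (_ , (_ , (() , _)) , _)
  CornerRank⇒capture {suc β} cr = dominating⇒capture β λ u su →
    CornerRank⇒clique cr (retraction (suc β) zero) u (retraction-into (suc β)) su

  capture⇒CornerRank-bound : CornerRank G α → CanCaptureWithin G s → α ≤ suc s
  capture⇒CornerRank-bound {s = s} cr cap = ≮⇒≥ λ s<α →
    CornerRank⇒no-earlier-clique cr (suc s) (s≤s z≤n) s<α (capture⇒clique s cap)

  capture⇒OneCopWinCond : ∀ β → CornerRank G (suc (suc β)) → CanCaptureWithin G (suc β) →
                          OneCopWinCond G (suc (suc β))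
  capture⇒OneCopWinCond β cr (c₀ , win) =
    retraction (suc (suc β)) c₀ ,
    (s≤s z≤n , CornerRank⇒no-earlier-clique cr , retraction-into (suc (suc β)) ,
     inj₂ (CornerRank⇒clique cr)) ,
    capture⇒dominating β win

  first-clique⇒CornerRank : IsClique G (Stage G (suc k)) →
                            (∀ {j} → j < k → ¬ IsClique G (Stage G (suc j))) →
                            CornerRank G (suc k)
  first-clique⇒CornerRank {k} clique earlier =
    ranked ,
    (retraction (suc k) zero , s≤s z≤n , no-earlier , retraction-into (suc k) , inj₂ clique) ,
    bounded
    where
    no-earlier : ∀ j → 1 ≤ j → j < suc k → ¬ IsClique G (Stage G j)
    no-earlier (suc j) _ (s≤s j<k) = earlier j<k

    -- The rank of x is one more than the first j with x a strict corner of
    -- Stage (suc j), or suc k if there is none up to k.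
    ranked : ∀ x → ∃ (HasRank G x)
    ranked x with least (λ j → StrictCorner? (Stage? (suc j)) x ⊎-dec (j ≟ℕ k)) (inj₂ refl)
    ... | j , leaves , below =
      suc j , s≤s z≤n , (λ i 1≤i i≤j → no-earlier i 1≤i (≤-trans i≤j (s≤s j≤k))) ,
      survives-until j (λ i<j sc → below i<j (inj₁ sc)) ,
      [ inj₁ , (λ { refl → inj₂ clique }) ] leaves
      where
      j≤k : j ≤ k
      j≤k = ≮⇒≥ λ k<j → below k<j (inj₂ refl)

    bounded : ∀ x j → HasRank G x j → j ≤ suc k
    bounded _ _ (_ , earlier′ , _) = ≮⇒≥ λ k<j → earlier′ (suc k) (s≤s z≤n) k<j clique

  clique⇒FiniteCornerRank : IsClique G (Stage G (suc t)) → FiniteCornerRank G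
  clique⇒FiniteCornerRank clique with least (λ j → IsClique? (suc j)) clique
  ... | k , clique-k , earlier = suc k , first-clique⇒CornerRank clique-k earlier

  RCopWin⇒CaptureTime : ∀ r α → RCopWin G r α → CaptureTime G (α ∸ r)
  RCopWin⇒CaptureTime r (suc (suc β)) (cr , _ , inj₁ (refl , _ , _ , dominating)) =
    dominating⇒capture β dominating ,
    λ s cap → ≤-pred (capture⇒CornerRank-bound cr cap)
  RCopWin⇒CaptureTime r (suc (suc β)) (cr , _ , inj₂ (refl , ¬one-cop-win)) =
    CornerRank⇒capture cr ,
    λ s cap → ≮⇒≥ λ s<α →
      ¬one-cop-win (capture⇒OneCopWinCond β cr (CanCaptureWithin-mono (≤-pred s<α) cap))
  RCopWin⇒CaptureTime r zero       (_ , () , _)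
  RCopWin⇒CaptureTime r (suc zero) (_ , s≤s () , _)

theorem6p1 : (G : Graph)
    → (CopWin G ⇔ FiniteCornerRank G)
      × (∀ (r α : ℕ) → RCopWin G r α → CaptureTime G (α ∸ r))
theorem6p1 G =
  mk⇔ (λ (t , cap) → clique⇒FiniteCornerRank G (capture⇒clique G t cap))
      (λ (α , cr) → α , CornerRank⇒capture G cr) ,
  RCopWin⇒CaptureTime G
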